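{- Let $q=p^k$ and $0\leq j\leq k-1$. The subgraph of the derangement graph of $\Gamma\mathrm{L}(2,q)$ induced by $V_{0,j}\cup V_{1,j}\cup\cdots\cup V_{q-2,j}$ is isomorphic to $\widetilde{K}_{q-1}^{q-1}\left[\overline{K_q}\right]$.
   Context: $\omega$ is a fixed primitive element of $\mathbb{F}_q$, $\varphi:x\mapsto x^p$. $\Gamma\mathrm{L}(2,q)$ is the group of maps $v\mapsto Av^{\varphi^i}$ ($A\in\mathrm{GL}(2,q)$, $\varphi^i$ applied entrywise) acting on non-zero vectors of $\mathbb{F}_q^2$; in products, a matrix $M$ denotes $v\mapsto Mv$, $\varphi^j$ denotes $v\mapsto v^{\varphi^j}$, $\omega^i$ the scalar map $v\mapsto\omega^i v$, juxtaposition is composition. The derangement graph has vertex set $\Gamma\mathrm{L}(2,q)$, with $g\sim h$ iff $h^{ -1}g$ fixes no non-zero vector. $V_{i,j}=\{\omega^i\varphi^j\begin{bmatrix}1&z\\0&y\end{bmatrix}: z\in\mathbb{F}_q, y\in\mathbb{F}_q^*\}$. $\overline{K_n}$ is the edgeless graph on $n$ vertices; $K_n^t$ is the complete multipartite graph with $t$ parts of size $n$, and $\widetilde{K}_n^t$ is obtained from $K_n^t$ by deleting the edges of $n$ vertex-disjoint copies of $K_t$. The lexicographic product $X[Y]$ has vertex set $V(X)\times V(Y)$, with $(x,y)\sim(x',y')$ iff $x\sim_X x'$, or $x=x'$ and $y\sim_Y y'$. -}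

module Defs where

open import Data.Nat as ℕ using (ℕ; zero; suc; _<_; _∸_)
open import Data.Fin using (Fin)
open import Data.Product using (Σ; ∃; _×_; _,_; proj₁; proj₂)
open import Relation.Binary.PropositionalEquality using (_≡_; _≢_)
open import Relation.Nullary using (¬_)
open import Algebra.Structures using (IsCommutativeRing)
open import Function.Bundles using (_↔_)

record Graph : Set₁ where
  field
    V   : Set
    _≈_ : V → V → Set
    Adj : V → V → Set

open Graph

Induced : (G : Graph) → (V G → Set) → Graph
Induced G P = record
  { V   = Σ (V G) P
  ; _≈_ = λ x y → _≈_ G (proj₁ x) (proj₁ y)
  ; Adj = λ x y → Adj G (proj₁ x) (proj₁ y)
  }

EdgelessK : ℕ → Graph
EdgelessK n = record { V = Fin n ; _≈_ = _≡_ ; Adj = λ _ _ → Data.Empty.⊥ }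
  where import Data.Empty

-- K̃_n^t : t parts of size n (vertex (a , b) = b-th vertex of part a);
-- complete multipartite K_n^t with the edges of the n vertex-disjoint
-- copies of K_t  { (a , b) : a ∈ Fin t }  (b ∈ Fin n) deleted.
Ktilde : (n t : ℕ) → Graph
Ktilde n t = record
  { V   = Fin t × Fin n
  ; _≈_ = _≡_
  ; Adj = λ x y → (proj₁ x ≢ proj₁ y) × (proj₂ x ≢ proj₂ y)
  }

Lex : Graph → Graph → Graph
Lex X Y = record
  { V   = V X × V Y
  ; _≈_ = λ x y → _≈_ X (proj₁ x) (proj₁ y) × _≈_ Y (proj₂ x) (proj₂ y)
  ; Adj = λ x y → Adj X (proj₁ x) (proj₁ y)
                  Data.Sum.⊎ (_≈_ X (proj₁ x) (proj₁ y) × Adj Y (proj₂ x) (proj₂ y))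
  }
  where import Data.Sum

record _≅_ (G H : Graph) : Set where
  field
    f         : V G → V H
    f-cong    : ∀ {x y} → _≈_ G x y → _≈_ H (f x) (f y)
    injective : ∀ {x y} → _≈_ H (f x) (f y) → _≈_ G x y
    surjective : ∀ y → ∃ λ x → _≈_ H (f x) y
    adj-pres  : ∀ {x y} → Adj G x y → Adj H (f x) (f y)
    adj-refl  : ∀ {x y} → Adj H (f x) (f y) → Adj G x y

record FiniteField : Set₁ where
  field
    F   : Set
    _+_ _*_ : F → F → F
    -_  : F → F
    0# 1# : F
    isCommutativeRing : IsCommutativeRing _≡_ _+_ _*_ -_ 0# 1#
    0≢1 : 0# ≢ 1#
    inverse : ∀ x → x ≢ 0# → ∃ λ y → x * y ≡ 1#
    size : ℕ
    enum : F ↔ Fin size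

module GammaL (𝔽 : FiniteField) (p : ℕ) where
  open FiniteField 𝔽

  infixr 8 _^_
  _^_ : F → ℕ → F
  x ^ zero  = 1#
  x ^ suc n = x * (x ^ n)

  Primitive : F → Set
  Primitive ω = ∀ x → x ≢ 0# → ∃ λ i → ω ^ i ≡ x

  -- φ^j : x ↦ x^(p^j), i.e. the j-fold iterate of x ↦ x^p
  φ^ : ℕ → F → F
  φ^ zero    x = x
  φ^ (suc j) x = φ^ j x ^ p

  Vec2 : Set
  Vec2 = F × F

  NonZero : Vec2 → Set
  NonZero v = v ≢ (0# , 0#)

  φ^v : ℕ → Vec2 → Vec2
  φ^v j (x , y) = (φ^ j x , φ^ j y)

  scale : F → Vec2 → Vec2
  scale c (x , y) = (c * x , c * y)

  record Mat2 : Set where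
    constructor mat
    field a b c d : F

  _·_ : Mat2 → Vec2 → Vec2
  mat a b c d · (x , y) = ((a * x) + (b * y) , (c * x) + (d * y))

  det : Mat2 → F
  det (mat a b c d) = (a * d) + (- (b * c))

  -- an element of ΓL(2,q): v ↦ A v^{φ^i}, A ∈ GL(2,q)
  record ΓL : Set where
    field
      A    : Mat2
      detA : det A ≢ 0#
      i    : ℕ

  act : ΓL → Vec2 → Vec2
  act g v = ΓL.A g · φ^v (ΓL.i g) v

  _≈Γ_ : ΓL → ΓL → Set
  g ≈Γ h = ∀ v → NonZero v → act g v ≡ act h v

  -- h⁻¹g fixes v  ⇔  g v = h v
  FixesNoNonZero⁻¹ : ΓL → ΓL → Set
  FixesNoNonZero⁻¹ h g = ¬ (∃ λ v → NonZero v × act g v ≡ act h v)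

  Derangement : Graph
  Derangement = record
    { V   = ΓL
    ; _≈_ = _≈Γ_
    ; Adj = λ g h → FixesNoNonZero⁻¹ h g
    }

  InV : F → ℕ → ℕ → ΓL → Set
  InV ω i j g = ∃ λ z → ∃ λ y → (y ≢ 0#) ×
    (∀ v → NonZero v → act g v ≡ scale (ω ^ i) (φ^v j (mat 1# z 0# y · v)))

  InUnion : F → ℕ → ΓL → Set
  InUnion ω j g = ∃ λ i → (i < size ∸ 1) × InV ω i j g

{-# OPTIONS --safe #-}
-- Every g ∈ V_{i,j} acts on non-zero vectors as v ↦ T v^{φ^j} with T upper triangular,
-- T = [[ω^i , ω^i z^{φ^j}] , [0 , ω^i y^{φ^j}]], and φ^j is a field automorphism since
-- |F| = p^k forces characteristic p. Two such maps agree on a non-zero vector iff T − T′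
-- is singular, i.e. iff the (1,1) entries or the (2,2) entries of T and T′ agree, and g is
-- determined by T. So g ↦ ((i , ω^i y^{φ^j}) , ω^i z^{φ^j}) identifies the subgraph with
-- K̃_{q−1}^{q−1}[K̄_q]: the part is i, the copy of K_{q−1} is the unit ω^i y^{φ^j}, and the
-- entry ω^i z^{φ^j} ∈ F is the coordinate in K̄_q.
module Submission where

open import Defs
open import Algebra.Bundles using (CommutativeRing; CancellativeCommutativeSemiring)
open import Data.Empty using (⊥-elim)
open import Data.Fin as Fin using (Fin; toℕ; fromℕ<; punchIn; punchOut)
import Data.Fin.Properties as Finₚ
open import Data.Nat as ℕ using (ℕ; zero; suc; _<_; _≤_; _∸_; _!; z<s; s<s)
import Data.Nat.Properties as ℕₚ
open import Data.Nat.Combinatorics using (_C_; nCn≡1; k![n∸k]!∣n!)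
open import Data.Nat.Combinatorics.Specification using (nCk≡n!/k![n-k]!)
open import Data.Nat.Divisibility using (_∣_; divides; ∣⇒≤; ∣1⇒≡1; m∣m*n)
open import Data.Nat.DivMod using (_%_; _/_; m/n*n≡m; m≡m%n+[m/n]*n; m%n<n)
open import Data.Nat.Primality using (Prime; euclidsLemma; prime⇒nonTrivial; prime⇒nonZero; ¬prime[0])
open import Data.Product using (Σ; ∃; _×_; _,_; proj₁; proj₂)
open import Data.Sum using (_⊎_; inj₁; inj₂)
open import Function using (_∘_)
open import Function.Bundles using (_↔_; Inverse; Injection; mk↔ₛ′)
open import Function.Construct.Composition using (_↔-∘_)
open import Function.Construct.Symmetry using (↔-sym)
open import Function.Definitions using (Injective)
open import Function.Properties.Inverse using (↔⇒↣)
open import Level using (0ℓ)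
open import Relation.Binary.Definitions using (tri<; tri≈; tri>)
open import Relation.Binary.PropositionalEquality
open import Relation.Nullary using (¬_; Dec; yes; no)
import Relation.Nullary.Decidable as Dec

prime∤n! : ∀ {p} → Prime p → ∀ {n} → n < p → ¬ p ∣ n !
prime∤n! p-prime {zero}  _   p∣1  = ℕ.nonTrivial⇒≢1 {{prime⇒nonTrivial p-prime}} (∣1⇒≡1 p∣1)
prime∤n! p-prime {suc n} n<p p∣n! with euclidsLemma (suc n) (n !) p-prime p∣n!
... | inj₁ p∣1+n = ℕₚ.<⇒≱ n<p (∣⇒≤ p∣1+n)
... | inj₂ p∣n!′ = prime∤n! p-prime (ℕₚ.<-trans (ℕₚ.n<1+n n) n<p) p∣n!′

nCk*[k!*[n∸k]!]≡n! : ∀ {n k} → k ≤ n → (n C k) ℕ.* (k ! ℕ.* (n ∸ k) !) ≡ n !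
nCk*[k!*[n∸k]!]≡n! {n} {k} k≤n =
  trans (cong (ℕ._* (k ! ℕ.* (n ∸ k) !)) (nCk≡n!/k![n-k]! k≤n))
        (m/n*n≡m {{ℕₚ._!*_!≢0 k (n ∸ k)}} (k![n∸k]!∣n! k≤n))

prime∣pCk : ∀ {r k} → Prime (suc r) → 0 < k → k < suc r → suc r ∣ suc r C k
prime∣pCk {r} {k} p-prime 0<k k<p
  with euclidsLemma (suc r C k) (k ! ℕ.* (suc r ∸ k) !) p-prime
         (subst (suc r ∣_) (sym (nCk*[k!*[n∸k]!]≡n! (ℕₚ.<⇒≤ k<p))) (m∣m*n (r !)))
... | inj₁ p∣pCk = p∣pCk
... | inj₂ p∣k!*[p∸k]! with euclidsLemma (k !) ((suc r ∸ k) !) p-prime p∣k!*[p∸k]!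
...   | inj₁ p∣k!     = ⊥-elim (prime∤n! p-prime k<p p∣k!)
...   | inj₂ p∣[p∸k]! = ⊥-elim (prime∤n! p-prime (ℕₚ.∸-monoʳ-< 0<k (ℕₚ.<⇒≤ k<p)) p∣[p∸k]!)

Fin-injective⇒surjective : ∀ {n} {f : Fin n → Fin n} → Injective _≡_ _≡_ f → ∀ y → ∃ λ x → f x ≡ y
Fin-injective⇒surjective {suc n} {f} f-injective y with Finₚ.any? (λ x → f x Finₚ.≟ y)
... | yes hit  = hit
... | no  miss = ⊥-elim (ℕₚ.1+n≰n (Finₚ.injective⇒≤ f-avoiding-y-injective))
  where
  f-avoiding-y : Fin (suc n) → Fin n
  f-avoiding-y x = punchOut {i = y} {j = f x} (λ y≡fx → miss (x , sym y≡fx))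
  f-avoiding-y-injective : Injective _≡_ _≡_ f-avoiding-y
  f-avoiding-y-injective = f-injective ∘ Finₚ.punchOut-injective {i = y} _ _

module Enumerated {A : Set} {n : ℕ} (enum : A ↔ Fin n) where
  open Inverse enum using (to; from)

  to-injective : Injective _≡_ _≡_ to
  to-injective = Injection.injective (↔⇒↣ enum)

  from-injective : Injective _≡_ _≡_ from
  from-injective = Injection.injective (↔⇒↣ (↔-sym enum))

  _≟_ : (x y : A) → Dec (x ≡ y)
  x ≟ y = Dec.map′ to-injective (cong to) (to x Finₚ.≟ to y)

  injective⇒surjective : {f : A → A} → Injective _≡_ _≡_ f → ∀ y → ∃ λ x → f x ≡ y
  injective⇒surjective {f} f-injective y
    with i , to[f[from-i]]≡to-y ← Fin-injective⇒surjective {f = to ∘ f ∘ from}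
                                    (from-injective ∘ f-injective ∘ to-injective) (to y)
    = from i , to-injective to[f[from-i]]≡to-y

module Punctured {A : Set} {n : ℕ} (enum : A ↔ Fin (suc n)) (a₀ : A) where
  open Inverse enum using (to; from; strictlyInverseˡ; strictlyInverseʳ)
  open Enumerated enum using (to-injective; from-injective)

  index : (x : A) → x ≢ a₀ → Fin n
  index x x≢a₀ = punchOut {i = to a₀} {j = to x} (x≢a₀ ∘ to-injective ∘ sym)

  element : Fin n → A
  element b = from (punchIn (to a₀) b)

  element≢ : ∀ b → element b ≢ a₀
  element≢ b eb≡a₀ = Finₚ.punchInᵢ≢i (to a₀) b (trans (sym (strictlyInverseˡ _)) (cong to eb≡a₀))

  element-injective : Injective _≡_ _≡_ element
  element-injective = Finₚ.punchIn-injective (to a₀) _ _ ∘ from-injective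

  element-index : ∀ x x≢a₀ → element (index x x≢a₀) ≡ x
  element-index x _ = trans (cong from (Finₚ.punchIn-punchOut _)) (strictlyInverseʳ x)

  index-element : ∀ b eb≢a₀ → index (element b) eb≢a₀ ≡ b
  index-element b _ = trans (Finₚ.punchOut-cong (to a₀) (strictlyInverseˡ _)) (Finₚ.punchOut-punchIn (to a₀))

  index-cong : ∀ {x y} x≢a₀ y≢a₀ → x ≡ y → index x x≢a₀ ≡ index y y≢a₀
  index-cong _ _ refl = Finₚ.punchOut-cong (to a₀) refl

  index-injective : ∀ {x y} x≢a₀ y≢a₀ → index x x≢a₀ ≡ index y y≢a₀ → x ≡ y
  index-injective {x} {y} x≢a₀ y≢a₀ ix≡iy =
    trans (sym (element-index x x≢a₀)) (trans (cong element ix≡iy) (element-index y y≢a₀))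

module FieldProperties (𝔽 : FiniteField) where
  open FiniteField 𝔽 using (isCommutativeRing; 0≢1; inverse)
  open FiniteField 𝔽 public using (F; size; enum)
  open ≡-Reasoning

  commutativeRing : CommutativeRing 0ℓ 0ℓ
  commutativeRing = record { isCommutativeRing = isCommutativeRing }

  open CommutativeRing commutativeRing public
    using ( _+_; _*_; -_; _-_; 0#; 1#; +-assoc; +-comm; +-identityˡ; +-identityʳ
          ; *-assoc; *-comm; *-identityˡ; *-identityʳ; zeroˡ; zeroʳ; distribˡ; distribʳ
          ; semiring; commutativeSemiring; +-group; *-monoid; +-commutativeMonoid)
  open import Algebra.Properties.Semiring.Exp semiring public using (_^_; ^-homo-*; ^-assocʳ)
  open import Algebra.Properties.CommutativeSemiring.Exp commutativeSemiring public using (^-distrib-*)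
  open import Algebra.Properties.Semiring.Mult semiring public
    using (×1-homo-*; ×-assoc-*; ×-assocˡ) renaming (_×_ to _⨰_)
  open import Algebra.Properties.Group +-group public
    using (identityˡ-unique; x∙y⁻¹≈ε⇒x≈y; ε⁻¹≈ε; \\-leftDividesˡ; \\-leftDividesʳ; //-rightDividesˡ)
  open import Algebra.Properties.Monoid *-monoid using (cancelˡ)
  open Enumerated enum public using (_≟_; injective⇒surjective)

  1≢0 : 1# ≢ 0#
  1≢0 = 0≢1 ∘ sym

  ∃-quotient : ∀ {c} → c ≢ 0# → ∀ b → ∃ λ x → c * x ≡ b
  ∃-quotient {c} c≢0 b with c⁻¹ , c*c⁻¹≡1 ← inverse c c≢0 = c⁻¹ * b , cancelˡ c*c⁻¹≡1 b

  *-cancelˡ-nonZero : ∀ x y z → x ≢ 0# → x * y ≡ x * z → y ≡ z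
  *-cancelˡ-nonZero x y z x≢0 xy≡xz with x⁻¹ , x*x⁻¹≡1 ← inverse x x≢0 = begin
    y              ≡⟨ cancelˡ x⁻¹*x≡1 y ⟨
    x⁻¹ * (x * y)  ≡⟨ cong (x⁻¹ *_) xy≡xz ⟩
    x⁻¹ * (x * z)  ≡⟨ cancelˡ x⁻¹*x≡1 z ⟩
    z              ∎
    where
    x⁻¹*x≡1 : x⁻¹ * x ≡ 1#
    x⁻¹*x≡1 = trans (*-comm x⁻¹ x) x*x⁻¹≡1

  cancellativeCommutativeSemiring : CancellativeCommutativeSemiring 0ℓ 0ℓ
  cancellativeCommutativeSemiring = record
    { isCancellativeCommutativeSemiring = record
      { isCommutativeSemiring = CommutativeRing.isCommutativeSemiring commutativeRing
      ; *-cancelˡ-nonZero     = *-cancelˡ-nonZero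
      }
    }

  open import Algebra.Properties.CancellativeCommutativeSemiring cancellativeCommutativeSemiring
    public using (*-almostCancelʳ; x≉0∧y≉0⇒xy≉0)

  *-nonZero : ∀ {x y} → x ≢ 0# → y ≢ 0# → x * y ≢ 0#
  *-nonZero = x≉0∧y≉0⇒xy≉0 _≟_

  ^-nonZero : ∀ {x} n → x ≢ 0# → x ^ n ≢ 0#
  ^-nonZero zero    _   = 1≢0
  ^-nonZero (suc n) x≢0 = *-nonZero x≢0 (^-nonZero n x≢0)

  ^≡0⇒≡0 : ∀ {x} n → x ^ n ≡ 0# → x ≡ 0#
  ^≡0⇒≡0 {x} n xⁿ≡0 with x ≟ 0#
  ... | yes x≡0 = x≡0
  ... | no  x≢0 = ⊥-elim (^-nonZero n x≢0 xⁿ≡0)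

  1^n≡1 : ∀ n → 1# ^ n ≡ 1#
  1^n≡1 zero    = refl
  1^n≡1 (suc n) = trans (*-identityˡ _) (1^n≡1 n)

  #F* : ℕ
  #F* = size ∸ 1

  enum* : F ↔ Fin (suc #F*)
  enum* = subst (λ n → F ↔ Fin n) (sym (ℕₚ.suc-pred size {{Finₚ.nonZeroIndex (Inverse.to enum 0#)}})) enum

  open Punctured enum* 0# public

  translation : F → F ↔ F
  translation x = mk↔ₛ′ (x +_) (- x +_) (\\-leftDividesˡ x) (\\-leftDividesʳ x)

  open import Algebra.Properties.CommutativeMonoid.Sum +-commutativeMonoid
    using (sum; ∑-permute; ∑-distrib-+; sum-cong-≗; sum-replicate; sum-replicate-zero; sum-init-last)

  -- Translation by x permutes F, so ∑ F = size ⨰ x + ∑ F.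
  size⨰x≡0 : ∀ x → size ⨰ x ≡ 0#
  size⨰x≡0 x = identityˡ-unique (size ⨰ x) (sum elements) (sym (begin
    sum elements                                      ≡⟨ ∑-permute elements shift ⟩
    sum {size} (λ i → elements (to (x + elements i))) ≡⟨ sum-cong-≗ (strictlyInverseʳ ∘ (x +_) ∘ elements) ⟩
    sum {size} (λ i → x + elements i)                 ≡⟨ ∑-distrib-+ (λ _ → x) elements ⟩
    sum {size} (λ _ → x) + sum elements               ≡⟨ cong (_+ sum elements) (sum-replicate size) ⟩
    size ⨰ x + sum elements                           ∎))
    where
    open Inverse enum using (to; strictlyInverseʳ) renaming (from to elements)
    shift : Fin size ↔ Fin size
    shift = enum ↔-∘ (translation x ↔-∘ ↔-sym enum)

  module Primitive (ω : F) (ω-generates : ∀ x → x ≢ 0# → ∃ λ i → ω ^ i ≡ x) where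

    log : Fin #F* → ℕ
    log b = proj₁ (ω-generates (element b) (element≢ b))

    ω^log : ∀ b → ω ^ log b ≡ element b
    ω^log b = proj₂ (ω-generates (element b) (element≢ b))

    -- ω = 0 generates F* = {ω ^ 0} when size = 2, hence the hypothesis 1 < #F*.
    ω≢0 : 1 < #F* → ω ≢ 0#
    ω≢0 1<#F* ω≡0 =
      ℕₚ.<⇒≱ 1<#F* (Finₚ.injective⇒≤ {f = λ (_ : Fin #F*) → Fin.zero {0}} constant-injective)
      where
      element≡1 : ∀ b → element b ≡ 1#
      element≡1 b with log b | ω^log b
      ... | zero  | 1≡eb   = sym 1≡eb
      ... | suc i | ωωⁱ≡eb =
        ⊥-elim (element≢ b (trans (sym ωωⁱ≡eb) (trans (cong (_* (ω ^ i)) ω≡0) (zeroˡ _))))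
      constant-injective : ∀ {a b} → Fin.zero ≡ Fin.zero → a ≡ b
      constant-injective {a} {b} _ = element-injective (trans (element≡1 a) (sym (element≡1 b)))

    ω^i≢0 : ∀ {i} → i < #F* → ω ^ i ≢ 0#
    ω^i≢0 {zero}  _      = 1≢0
    ω^i≢0 {suc i} i<#F* = ^-nonZero (suc i) (ω≢0 (ℕₚ.≤-<-trans (ℕ.s≤s ℕ.z≤n) i<#F*))

    ω^i≡ω^[i%d] : ∀ {d} .{{_ : ℕ.NonZero d}} → ω ^ d ≡ 1# → ∀ i → ω ^ i ≡ ω ^ (i % d)
    ω^i≡ω^[i%d] {d} ω^d≡1 i = begin
      ω ^ i                             ≡⟨ cong (ω ^_) (m≡m%n+[m/n]*n i d) ⟩
      ω ^ (i % d ℕ.+ i / d ℕ.* d)       ≡⟨ ^-homo-* ω (i % d) (i / d ℕ.* d) ⟩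
      ω ^ (i % d) * ω ^ (i / d ℕ.* d)   ≡⟨ cong (λ n → ω ^ (i % d) * ω ^ n) (ℕₚ.*-comm (i / d) d) ⟩
      ω ^ (i % d) * ω ^ (d ℕ.* (i / d)) ≡⟨ cong (ω ^ (i % d) *_) (^-assocʳ ω d (i / d)) ⟨
      ω ^ (i % d) * (ω ^ d) ^ (i / d)   ≡⟨ cong (λ y → ω ^ (i % d) * y ^ (i / d)) ω^d≡1 ⟩
      ω ^ (i % d) * 1# ^ (i / d)        ≡⟨ cong (ω ^ (i % d) *_) (1^n≡1 (i / d)) ⟩
      ω ^ (i % d) * 1#                  ≡⟨ *-identityʳ _ ⟩
      ω ^ (i % d)                       ∎

    -- If ω ^ d ≡ 1 then every unit is ω ^ r with r < d, so the units would inject into Fin d.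
    ω^d≢1 : ∀ {d} → 0 < d → d < #F* → ω ^ d ≢ 1#
    ω^d≢1 {suc d} _ d<#F* ω^d≡1 = Finₚ.<⇒notInjective d<#F* residue-injective
      where
      residue : Fin #F* → Fin (suc d)
      residue b = fromℕ< (m%n<n (log b) (suc d))
      residue-injective : Injective _≡_ _≡_ residue
      residue-injective {a} {b} ra≡rb = element-injective (begin
        element a           ≡⟨ ω^log a ⟨
        ω ^ log a           ≡⟨ ω^i≡ω^[i%d] ω^d≡1 (log a) ⟩
        ω ^ (log a % suc d) ≡⟨ cong (ω ^_) (Finₚ.fromℕ<-injective _ _ _ _ ra≡rb) ⟩
        ω ^ (log b % suc d) ≡⟨ ω^i≡ω^[i%d] ω^d≡1 (log b) ⟨
        ω ^ log b           ≡⟨ ω^log b ⟩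
        element b           ∎)

    ω^a≢ω^b : ∀ {a b} → a < b → b < #F* → ω ^ a ≢ ω ^ b
    ω^a≢ω^b {a} {b} a<b b<#F* ω^a≡ω^b =
      ω^d≢1 (ℕₚ.m<n⇒0<n∸m a<b) (ℕₚ.≤-<-trans (ℕₚ.m∸n≤m b a) b<#F*)
        (*-cancelˡ-nonZero (ω ^ a) _ _ (ω^i≢0 (ℕₚ.<-trans a<b b<#F*)) (begin
          ω ^ a * ω ^ (b ∸ a)  ≡⟨ ^-homo-* ω a (b ∸ a) ⟨
          ω ^ (a ℕ.+ (b ∸ a))  ≡⟨ cong (ω ^_) (ℕₚ.m+[n∸m]≡n (ℕₚ.<⇒≤ a<b)) ⟩
          ω ^ b                ≡⟨ ω^a≡ω^b ⟨
          ω ^ a                ≡⟨ *-identityʳ _ ⟨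
          ω ^ a * 1#           ∎))

    ω^-injective : ∀ {a b} → a < #F* → b < #F* → ω ^ a ≡ ω ^ b → a ≡ b
    ω^-injective {a} {b} a<#F* b<#F* ω^a≡ω^b with ℕₚ.<-cmp a b
    ... | tri< a<b _ _ = ⊥-elim (ω^a≢ω^b a<b b<#F* ω^a≡ω^b)
    ... | tri≈ _ a≡b _ = a≡b
    ... | tri> _ _ b<a = ⊥-elim (ω^a≢ω^b b<a a<#F* (sym ω^a≡ω^b))

  ℕ^⨰1 : ∀ m n → (m ℕ.^ n) ⨰ 1# ≡ (m ⨰ 1#) ^ n
  ℕ^⨰1 m zero    = +-identityʳ 1#
  ℕ^⨰1 m (suc n) = trans (×1-homo-* m (m ℕ.^ n)) (cong ((m ⨰ 1#) *_) (ℕ^⨰1 m n))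

  ∣⇒⨰≡0 : ∀ {p n} → (∀ x → p ⨰ x ≡ 0#) → p ∣ n → ∀ x → n ⨰ x ≡ 0#
  ∣⇒⨰≡0 {p} p⨰≡0 (divides c refl) x = begin
    (c ℕ.* p) ⨰ x  ≡⟨ cong (_⨰ x) (ℕₚ.*-comm c p) ⟩
    (p ℕ.* c) ⨰ x  ≡⟨ ×-assocˡ x p c ⟨
    p ⨰ (c ⨰ x)    ≡⟨ p⨰≡0 (c ⨰ x) ⟩
    0#             ∎

  freshman's-dream : ∀ {p} → Prime p → (∀ x → p ⨰ x ≡ 0#) → ∀ x y → (x + y) ^ p ≡ x ^ p + y ^ p
  freshman's-dream {zero}  p-prime = ⊥-elim (¬prime[0] p-prime)
  freshman's-dream {suc r} p-prime p⨰≡0 x y = begin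
    (x + y) ^ p                                   ≡⟨ theorem p x y ⟩
    term Fin.zero + sum (term ∘ Fin.suc)          ≡⟨ cong (term Fin.zero +_) (sum-init-last (term ∘ Fin.suc)) ⟩
    term Fin.zero + (sum inner + term (Fin.fromℕ p))
      ≡⟨ cong (λ s → term Fin.zero + (s + term (Fin.fromℕ p)))
              (trans (sum-cong-≗ inner≡0) (sum-replicate-zero r)) ⟩
    term Fin.zero + (0# + term (Fin.fromℕ p))     ≡⟨ cong₂ _+_ first (trans (+-identityˡ _) last) ⟩
    y ^ p + x ^ p                                 ≡⟨ +-comm _ _ ⟩
    x ^ p + y ^ p                                 ∎
    where
    open import Algebra.Properties.CommutativeSemiring.Binomial commutativeSemiring using (theorem; binomialTerm)
    p : ℕ
    p = suc r
    term : Fin (suc p) → F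
    term = binomialTerm x y p
    inner : Fin r → F
    inner = term ∘ Fin.suc ∘ Fin.inject₁
    inner≡0 : ∀ i → inner i ≡ 0#
    inner≡0 i = ∣⇒⨰≡0 p⨰≡0 (prime∣pCk p-prime z<s (s<s i<r)) _
      where
      i<r : toℕ (Fin.inject₁ i) < r
      i<r = subst (_< r) (sym (Finₚ.toℕ-inject₁ i)) (Finₚ.toℕ<n i)
    first : term Fin.zero ≡ y ^ p
    first = trans (+-identityʳ _) (*-identityˡ _)
    last : term (Fin.fromℕ p) ≡ x ^ p
    last = begin
      term (Fin.fromℕ p)               ≡⟨ cong (λ t → (p C t) ⨰ (x ^ t * y ^ (p ∸ t))) (Finₚ.toℕ-fromℕ p) ⟩
      (p C p) ⨰ (x ^ p * y ^ (p ∸ p))  ≡⟨ cong₂ (λ c e → c ⨰ (x ^ p * y ^ e)) (nCn≡1 p) (ℕₚ.n∸n≡0 p) ⟩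
      1 ⨰ (x ^ p * 1#)                 ≡⟨ trans (+-identityʳ _) (*-identityʳ _) ⟩
      x ^ p                            ∎

  module Characteristic {p k} (p-prime : Prime p) (size≡p^k : size ≡ p ℕ.^ k) where

    p⨰1≡0 : p ⨰ 1# ≡ 0#
    p⨰1≡0 = ^≡0⇒≡0 k (begin
      (p ⨰ 1#) ^ k    ≡⟨ ℕ^⨰1 p k ⟨
      (p ℕ.^ k) ⨰ 1#  ≡⟨ cong (_⨰ 1#) size≡p^k ⟨
      size ⨰ 1#       ≡⟨ size⨰x≡0 1# ⟩
      0#              ∎)

    p⨰x≡0 : ∀ x → p ⨰ x ≡ 0#
    p⨰x≡0 x = begin
      p ⨰ x         ≡⟨ cong (p ⨰_) (*-identityˡ x) ⟨
      p ⨰ (1# * x)  ≡⟨ ×-assoc-* p 1# x ⟨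
      (p ⨰ 1#) * x  ≡⟨ cong (_* x) p⨰1≡0 ⟩
      0# * x        ≡⟨ zeroˡ x ⟩
      0#            ∎

    0^p≡0 : 0# ^ p ≡ 0#
    0^p≡0 = trans (cong (0# ^_) (sym (ℕₚ.suc-pred p {{prime⇒nonZero p-prime}}))) (zeroˡ _)

    ^p-distrib-+ : ∀ x y → (x + y) ^ p ≡ x ^ p + y ^ p
    ^p-distrib-+ = freshman's-dream p-prime p⨰x≡0

    ^p-injective : ∀ {x y} → x ^ p ≡ y ^ p → x ≡ y
    ^p-injective {x} {y} x^p≡y^p = x∙y⁻¹≈ε⇒x≈y x y (^≡0⇒≡0 p (identityˡ-unique ((x - y) ^ p) (y ^ p) (begin
      (x - y) ^ p + y ^ p  ≡⟨ ^p-distrib-+ (x - y) y ⟨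
      (x - y + y) ^ p      ≡⟨ cong (_^ p) (//-rightDividesˡ y x) ⟩
      x ^ p                ≡⟨ x^p≡y^p ⟩
      y ^ p                ∎)))

module GammaLProperties (𝔽 : FiniteField) (p : ℕ) where
  open FieldProperties 𝔽
  open GammaL 𝔽 p renaming (_^_ to _^ᴳ_)
  open ≡-Reasoning

  ^ᴳ≡^ : ∀ x n → x ^ᴳ n ≡ x ^ n
  ^ᴳ≡^ x zero    = refl
  ^ᴳ≡^ x (suc n) = cong (x *_) (^ᴳ≡^ x n)

  upper : F → F → F → Mat2
  upper a b d = mat a b 0# d

  e₁ e₂ : Vec2
  e₁ = 1# , 0#
  e₂ = 0# , 1#

  e₁≢0 : NonZero e₁
  e₁≢0 = 1≢0 ∘ cong proj₁

  e₂≢0 : NonZero e₂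
  e₂≢0 = 1≢0 ∘ cong proj₂

  upper-cong : ∀ {a b d a′ b′ d′} → a ≡ a′ → b ≡ b′ → d ≡ d′ → upper a b d ≡ upper a′ b′ d′
  upper-cong refl refl refl = refl

  upper-· : ∀ a b d u₁ u₂ → upper a b d · (u₁ , u₂) ≡ (a * u₁ + b * u₂ , d * u₂)
  upper-· a b d u₁ u₂ = cong (a * u₁ + b * u₂ ,_) (trans (cong (_+ d * u₂) (zeroˡ u₁)) (+-identityˡ _))

  upper-·-e₁ : ∀ a b d → upper a b d · e₁ ≡ (a , 0#)
  upper-·-e₁ a b d = trans (upper-· a b d 1# 0#)
    (cong₂ _,_ (trans (cong₂ _+_ (*-identityʳ a) (zeroʳ b)) (+-identityʳ a)) (zeroʳ d))

  upper-·-e₂ : ∀ a b d → upper a b d · e₂ ≡ (b , d)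
  upper-·-e₂ a b d = trans (upper-· a b d 0# 1#)
    (cong₂ _,_ (trans (cong₂ _+_ (zeroʳ a) (*-identityʳ b)) (+-identityˡ b)) (*-identityʳ d))

  upper-·-[u,1] : ∀ a b d u → upper a b d · (u , 1#) ≡ (a * u + b , d)
  upper-·-[u,1] a b d u = trans (upper-· a b d u 1#) (cong₂ (λ s t → (a * u + s , t)) (*-identityʳ b) (*-identityʳ d))

  det-upper : ∀ a b d → det (upper a b d) ≡ a * d
  det-upper a b d = trans (cong (λ t → a * d + - t) (zeroʳ b)) (trans (cong (a * d +_) ε⁻¹≈ε) (+-identityʳ _))

  scale-upper : ∀ c b d u → scale c (upper 1# b d · u) ≡ upper c (c * b) (c * d) · u
  scale-upper c b d (u₁ , u₂) = begin
    scale c (upper 1# b d · (u₁ , u₂))       ≡⟨ cong (scale c) (upper-· 1# b d u₁ u₂) ⟩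
    (c * (1# * u₁ + b * u₂) , c * (d * u₂))  ≡⟨ cong₂ _,_ first (sym (*-assoc c d u₂)) ⟩
    (c * u₁ + c * b * u₂ , c * d * u₂)       ≡⟨ upper-· c (c * b) (c * d) u₁ u₂ ⟨
    upper c (c * b) (c * d) · (u₁ , u₂)      ∎
    where
    first : c * (1# * u₁ + b * u₂) ≡ c * u₁ + c * b * u₂
    first = trans (distribˡ c _ _) (cong₂ _+_ (cong (c *_) (*-identityˡ u₁)) (sym (*-assoc c b u₂)))

  upper-coincide⇒ : ∀ {a b d a′ b′ d′} u → NonZero u →
    upper a b d · u ≡ upper a′ b′ d′ · u → a ≡ a′ ⊎ d ≡ d′
  upper-coincide⇒ {a} {b} {d} {a′} {b′} {d′} (u₁ , u₂) u≢0 coincide with u₂ ≟ 0#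
  ... | yes refl = inj₁ (*-almostCancelʳ u₁ a a′ (u≢0 ∘ cong (_, 0#)) (begin
    a * u₁             ≡⟨ a*u₁+x*0≡a*u₁ a b ⟨
    a * u₁ + b * 0#    ≡⟨ cong proj₁ (trans (sym (upper-· a b d u₁ 0#))
                                             (trans coincide (upper-· a′ b′ d′ u₁ 0#))) ⟩
    a′ * u₁ + b′ * 0#  ≡⟨ a*u₁+x*0≡a*u₁ a′ b′ ⟩
    a′ * u₁            ∎))
    where
    a*u₁+x*0≡a*u₁ : ∀ a x → a * u₁ + x * 0# ≡ a * u₁
    a*u₁+x*0≡a*u₁ a x = trans (cong (a * u₁ +_) (zeroʳ x)) (+-identityʳ _)
  ... | no u₂≢0 = inj₂ (*-almostCancelʳ u₂ d d′ u₂≢0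
    (cong proj₂ (trans (sym (upper-· a b d u₁ u₂)) (trans coincide (upper-· a′ b′ d′ u₁ u₂)))))

  e₁-coincide : ∀ a b d b′ d′ → upper a b d · e₁ ≡ upper a b′ d′ · e₁
  e₁-coincide a b d b′ d′ = trans (upper-·-e₁ a b d) (sym (upper-·-e₁ a b′ d′))

  affine-coincide : ∀ {a b a′ b′ u} → (a - a′) * u ≡ b′ - b → a * u + b ≡ a′ * u + b′
  affine-coincide {a} {b} {a′} {b′} {u} [a-a′]u≡b′-b = begin
    a * u + b                      ≡⟨ cong (λ s → s * u + b) (//-rightDividesˡ a′ a) ⟨
    (a - a′ + a′) * u + b          ≡⟨ cong (_+ b) (trans (distribʳ u (a - a′) a′) (+-comm _ _)) ⟩
    a′ * u + (a - a′) * u + b      ≡⟨ +-assoc _ _ _ ⟩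
    a′ * u + ((a - a′) * u + b)    ≡⟨ cong (λ t → a′ * u + (t + b)) [a-a′]u≡b′-b ⟩
    a′ * u + (b′ - b + b)          ≡⟨ cong (a′ * u +_) (//-rightDividesˡ b b′) ⟩
    a′ * u + b′                    ∎

  upper-coincide⇐ : ∀ {a b d a′ b′ d′} → a ≡ a′ ⊎ d ≡ d′ →
    ∃ λ u → NonZero u × upper a b d · u ≡ upper a′ b′ d′ · u
  upper-coincide⇐ {a} {b} {d} {.a} {b′} {d′} (inj₁ refl) = e₁ , e₁≢0 , e₁-coincide a b d b′ d′
  upper-coincide⇐ {a} {b} {d} {a′} {b′} {.d} (inj₂ refl) with a ≟ a′
  ... | yes refl = e₁ , e₁≢0 , e₁-coincide a b d b′ d
  ... | no  a≢a′ with u , [a-a′]u≡b′-b ← ∃-quotient (a≢a′ ∘ x∙y⁻¹≈ε⇒x≈y a a′) (b′ - b) =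
    (u , 1#) , 1≢0 ∘ cong proj₂ , (begin
      upper a b d · (u , 1#)    ≡⟨ upper-·-[u,1] a b d u ⟩
      (a * u + b , d)           ≡⟨ cong (_, d) (affine-coincide [a-a′]u≡b′-b) ⟩
      (a′ * u + b′ , d)         ≡⟨ upper-·-[u,1] a′ b′ d u ⟨
      upper a′ b′ d · (u , 1#)  ∎)

  module FrobeniusPowers {k} (p-prime : Prime p) (size≡p^k : size ≡ p ℕ.^ k) where
    open Characteristic {k = k} p-prime size≡p^k

    φ^-suc : ∀ j x → φ^ (suc j) x ≡ φ^ j x ^ p
    φ^-suc j x = ^ᴳ≡^ (φ^ j x) p

    φ^-+ : ∀ j x y → φ^ j (x + y) ≡ φ^ j x + φ^ j y
    φ^-+ zero    x y = refl
    φ^-+ (suc j) x y = begin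
      φ^ (suc j) (x + y)           ≡⟨ φ^-suc j (x + y) ⟩
      φ^ j (x + y) ^ p             ≡⟨ cong (_^ p) (φ^-+ j x y) ⟩
      (φ^ j x + φ^ j y) ^ p        ≡⟨ ^p-distrib-+ (φ^ j x) (φ^ j y) ⟩
      φ^ j x ^ p + φ^ j y ^ p      ≡⟨ cong₂ _+_ (φ^-suc j x) (φ^-suc j y) ⟨
      φ^ (suc j) x + φ^ (suc j) y  ∎

    φ^-* : ∀ j x y → φ^ j (x * y) ≡ φ^ j x * φ^ j y
    φ^-* zero    x y = refl
    φ^-* (suc j) x y = begin
      φ^ (suc j) (x * y)           ≡⟨ φ^-suc j (x * y) ⟩
      φ^ j (x * y) ^ p             ≡⟨ cong (_^ p) (φ^-* j x y) ⟩
      (φ^ j x * φ^ j y) ^ p        ≡⟨ ^-distrib-* (φ^ j x) (φ^ j y) p ⟩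
      φ^ j x ^ p * φ^ j y ^ p      ≡⟨ cong₂ _*_ (φ^-suc j x) (φ^-suc j y) ⟨
      φ^ (suc j) x * φ^ (suc j) y  ∎

    φ^-0 : ∀ j → φ^ j 0# ≡ 0#
    φ^-0 zero    = refl
    φ^-0 (suc j) = trans (φ^-suc j 0#) (trans (cong (_^ p) (φ^-0 j)) 0^p≡0)

    φ^-1 : ∀ j → φ^ j 1# ≡ 1#
    φ^-1 zero    = refl
    φ^-1 (suc j) = trans (φ^-suc j 1#) (trans (cong (_^ p) (φ^-1 j)) (1^n≡1 p))

    φ^-injective : ∀ j → Injective _≡_ _≡_ (φ^ j)
    φ^-injective zero    x≡y         = x≡y
    φ^-injective (suc j) {x} {y} φx≡φy =
      φ^-injective j (^p-injective (trans (sym (φ^-suc j x)) (trans φx≡φy (φ^-suc j y))))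

    φ^-nonZero : ∀ j {x} → x ≢ 0# → φ^ j x ≢ 0#
    φ^-nonZero j x≢0 φx≡0 = x≢0 (φ^-injective j (trans φx≡0 (sym (φ^-0 j))))

    φ^-surjective : ∀ j y → ∃ λ x → φ^ j x ≡ y
    φ^-surjective j = injective⇒surjective (φ^-injective j)

    ∃-φ^-quotient : ∀ j {c} → c ≢ 0# → ∀ b → ∃ λ z → c * φ^ j z ≡ b
    ∃-φ^-quotient j c≢0 b with x , cx≡b ← ∃-quotient c≢0 b with z , φz≡x ← φ^-surjective j x =
      z , trans (cong (_ *_) φz≡x) cx≡b

    φ^v-0 : ∀ j → φ^v j (0# , 0#) ≡ (0# , 0#)
    φ^v-0 j = cong₂ _,_ (φ^-0 j) (φ^-0 j)

    φ^v-e₁ : ∀ j → φ^v j e₁ ≡ e₁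
    φ^v-e₁ j = cong₂ _,_ (φ^-1 j) (φ^-0 j)

    φ^v-e₂ : ∀ j → φ^v j e₂ ≡ e₂
    φ^v-e₂ j = cong₂ _,_ (φ^-0 j) (φ^-1 j)

    φ^v-injective : ∀ j → Injective _≡_ _≡_ (φ^v j)
    φ^v-injective j φv≡φw = cong₂ _,_ (φ^-injective j (cong proj₁ φv≡φw)) (φ^-injective j (cong proj₂ φv≡φw))

    φ^v-nonZero : ∀ j {v} → NonZero v → NonZero (φ^v j v)
    φ^v-nonZero j v≢0 φv≡0 = v≢0 (φ^v-injective j (trans φv≡0 (sym (φ^v-0 j))))

    φ^v-surjective : ∀ j u → NonZero u → ∃ λ v → NonZero v × φ^v j v ≡ u
    φ^v-surjective j (u₁ , u₂) u≢0
      with v₁ , φv₁≡u₁ ← φ^-surjective j u₁ with v₂ , φv₂≡u₂ ← φ^-surjective j u₂ =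
      (v₁ , v₂) , v≢0 , φv≡u
      where
      φv≡u : φ^v j (v₁ , v₂) ≡ (u₁ , u₂)
      φv≡u = cong₂ _,_ φv₁≡u₁ φv₂≡u₂
      v≢0 : NonZero (v₁ , v₂)
      v≢0 v≡0 = u≢0 (trans (sym φv≡u) (trans (cong (φ^v j) v≡0) (φ^v-0 j)))

    φ^v-upper-· : ∀ j a b d u → φ^v j (upper a b d · u) ≡ upper (φ^ j a) (φ^ j b) (φ^ j d) · φ^v j u
    φ^v-upper-· j a b d (u₁ , u₂) = begin
      φ^v j (upper a b d · (u₁ , u₂))                           ≡⟨ cong (φ^v j) (upper-· a b d u₁ u₂) ⟩
      (φ^ j (a * u₁ + b * u₂) , φ^ j (d * u₂))                  ≡⟨ cong₂ _,_ first (φ^-* j d u₂) ⟩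
      (φ^ j a * φ^ j u₁ + φ^ j b * φ^ j u₂ , φ^ j d * φ^ j u₂)  ≡⟨ upper-· (φ^ j a) (φ^ j b) (φ^ j d) _ _ ⟨
      upper (φ^ j a) (φ^ j b) (φ^ j d) · φ^v j (u₁ , u₂)        ∎
      where
      first : φ^ j (a * u₁ + b * u₂) ≡ φ^ j a * φ^ j u₁ + φ^ j b * φ^ j u₂
      first = trans (φ^-+ j _ _) (cong₂ _+_ (φ^-* j a u₁) (φ^-* j b u₂))

    scale-φ^v-upper : ∀ j c z y u →
      scale c (φ^v j (upper 1# z y · u)) ≡ upper c (c * φ^ j z) (c * φ^ j y) · φ^v j u
    scale-φ^v-upper j c z y u = begin
      scale c (φ^v j (upper 1# z y · u))                     ≡⟨ cong (scale c) (φ^v-upper-· j 1# z y u) ⟩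
      scale c (upper (φ^ j 1#) (φ^ j z) (φ^ j y) · φ^v j u)
        ≡⟨ cong (λ t → scale c (upper t (φ^ j z) (φ^ j y) · φ^v j u)) (φ^-1 j) ⟩
      scale c (upper 1# (φ^ j z) (φ^ j y) · φ^v j u)         ≡⟨ scale-upper c (φ^ j z) (φ^ j y) (φ^v j u) ⟩
      upper c (c * φ^ j z) (c * φ^ j y) · φ^v j u            ∎

module Subgraph (𝔽 : FiniteField) (p k : ℕ) (p-prime : Prime p) (size≡p^k : FiniteField.size 𝔽 ≡ p ℕ.^ k)
                (ω : FiniteField.F 𝔽) (ω-primitive : GammaL.Primitive 𝔽 p ω) (j : ℕ) where
  open FieldProperties 𝔽
  open GammaL 𝔽 p renaming (_^_ to _^ᴳ_)
  open GammaLProperties 𝔽 p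
  open FrobeniusPowers {k = k} p-prime size≡p^k
  open Inverse enum using (to; from; strictlyInverseˡ)
  open ≡-Reasoning

  ω-generates : ∀ x → x ≢ 0# → ∃ λ i → ω ^ i ≡ x
  ω-generates x x≢0 with i , ωⁱ≡x ← ω-primitive x x≢0 = i , trans (sym (^ᴳ≡^ ω i)) ωⁱ≡x

  open Primitive ω ω-generates

  φ : F → F
  φ = φ^ j

  G H : Graph
  G = Induced Derangement (InUnion ω j)
  H = Lex (Ktilde #F* #F*) (EdgelessK size)

  Vertex : Set
  Vertex = Σ ΓL (InUnion ω j)

  exponent : Vertex → ℕ
  exponent (_ , i , _) = i

  exponent< : ∀ x → exponent x < #F*
  exponent< (_ , _ , i< , _) = i<

  a₁₁ a₁₂ a₂₂ : Vertex → F
  a₁₁ x = ω ^ exponent x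
  a₁₂ (_ , i , _ , z , _) = ω ^ i * φ z
  a₂₂ (_ , i , _ , _ , y , _) = ω ^ i * φ y

  matrix : Vertex → Mat2
  matrix x = upper (a₁₁ x) (a₁₂ x) (a₂₂ x)

  a₂₂≢0 : ∀ x → a₂₂ x ≢ 0#
  a₂₂≢0 (_ , _ , i< , _ , _ , y≢0 , _) = *-nonZero (ω^i≢0 i<) (φ^-nonZero j y≢0)

  act-matrix : ∀ x v → NonZero v → act (proj₁ x) v ≡ matrix x · φ^v j v
  act-matrix (g , i , _ , z , y , _ , g≗) v v≢0 = begin
    act g v                                              ≡⟨ g≗ v v≢0 ⟩
    scale (ω ^ᴳ i) (φ^v j (upper 1# z y · v))            ≡⟨ cong (λ c → scale c (φ^v j (upper 1# z y · v))) (^ᴳ≡^ ω i) ⟩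
    scale (ω ^ i) (φ^v j (upper 1# z y · v))             ≡⟨ scale-φ^v-upper j (ω ^ i) z y v ⟩
    upper (ω ^ i) (ω ^ i * φ z) (ω ^ i * φ y) · φ^v j v  ∎

  act-e₁ : ∀ x → act (proj₁ x) e₁ ≡ (a₁₁ x , 0#)
  act-e₁ x = trans (act-matrix x e₁ e₁≢0) (trans (cong (matrix x ·_) (φ^v-e₁ j)) (upper-·-e₁ _ _ _))

  act-e₂ : ∀ x → act (proj₁ x) e₂ ≡ (a₁₂ x , a₂₂ x)
  act-e₂ x = trans (act-matrix x e₂ e₂≢0) (trans (cong (matrix x ·_) (φ^v-e₂ j)) (upper-·-e₂ _ _ _))

  ≈⇒entries≡ : ∀ {x y} → Graph._≈_ G x y → a₁₁ x ≡ a₁₁ y × a₁₂ x ≡ a₁₂ y × a₂₂ x ≡ a₂₂ y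
  ≈⇒entries≡ {x} {y} x≈y = cong proj₁ at-e₁ , cong proj₁ at-e₂ , cong proj₂ at-e₂
    where
    at-e₁ : (a₁₁ x , 0#) ≡ (a₁₁ y , 0#)
    at-e₁ = trans (sym (act-e₁ x)) (trans (x≈y e₁ e₁≢0) (act-e₁ y))
    at-e₂ : (a₁₂ x , a₂₂ x) ≡ (a₁₂ y , a₂₂ y)
    at-e₂ = trans (sym (act-e₂ x)) (trans (x≈y e₂ e₂≢0) (act-e₂ y))

  entries≡⇒≈ : ∀ {x y} → a₁₁ x ≡ a₁₁ y → a₁₂ x ≡ a₁₂ y → a₂₂ x ≡ a₂₂ y → Graph._≈_ G x y
  entries≡⇒≈ {x} {y} a₁₁≡ a₁₂≡ a₂₂≡ v v≢0 = begin
    act (proj₁ x) v     ≡⟨ act-matrix x v v≢0 ⟩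
    matrix x · φ^v j v  ≡⟨ cong (_· φ^v j v) (upper-cong a₁₁≡ a₁₂≡ a₂₂≡) ⟩
    matrix y · φ^v j v  ≡⟨ act-matrix y v v≢0 ⟨
    act (proj₁ y) v     ∎

  Coincide : Vertex → Vertex → Set
  Coincide x y = ∃ λ v → NonZero v × act (proj₁ x) v ≡ act (proj₁ y) v

  coincide⇒ : ∀ {x y} → Coincide x y → a₁₁ x ≡ a₁₁ y ⊎ a₂₂ x ≡ a₂₂ y
  coincide⇒ {x} {y} (v , v≢0 , xv≡yv) = upper-coincide⇒ (φ^v j v) (φ^v-nonZero j v≢0)
    (trans (sym (act-matrix x v v≢0)) (trans xv≡yv (act-matrix y v v≢0)))

  coincide⇐ : ∀ {x y} → a₁₁ x ≡ a₁₁ y ⊎ a₂₂ x ≡ a₂₂ y → Coincide x y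
  coincide⇐ {x} {y} diagonals-meet
    with u , u≢0 , xu≡yu ← upper-coincide⇐ diagonals-meet
    with v , v≢0 , φv≡u  ← φ^v-surjective j u u≢0 = v , v≢0 , (begin
      act (proj₁ x) v     ≡⟨ act-matrix x v v≢0 ⟩
      matrix x · φ^v j v  ≡⟨ cong (matrix x ·_) φv≡u ⟩
      matrix x · u        ≡⟨ xu≡yu ⟩
      matrix y · u        ≡⟨ cong (matrix y ·_) φv≡u ⟨
      matrix y · φ^v j v  ≡⟨ act-matrix y v v≢0 ⟨
      act (proj₁ y) v     ∎)

  part copy : Vertex → Fin #F*
  part x = fromℕ< (exponent< x)
  copy x = index (a₂₂ x) (a₂₂≢0 x)

  toH : Vertex → Graph.V H
  toH x = (part x , copy x) , to (a₁₂ x)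

  part≡⇒a₁₁≡ : ∀ {x y} → part x ≡ part y → a₁₁ x ≡ a₁₁ y
  part≡⇒a₁₁≡ {x} {y} = cong (ω ^_) ∘ Finₚ.fromℕ<-injective _ _ (exponent< x) (exponent< y)

  a₁₁≡⇒part≡ : ∀ {x y} → a₁₁ x ≡ a₁₁ y → part x ≡ part y
  a₁₁≡⇒part≡ {x} {y} ωⁱ≡ωⁱ′ =
    Finₚ.fromℕ<-cong _ _ (ω^-injective (exponent< x) (exponent< y) ωⁱ≡ωⁱ′) (exponent< x) (exponent< y)

  copy≡⇒a₂₂≡ : ∀ {x y} → copy x ≡ copy y → a₂₂ x ≡ a₂₂ y
  copy≡⇒a₂₂≡ {x} {y} = index-injective (a₂₂≢0 x) (a₂₂≢0 y)

  a₂₂≡⇒copy≡ : ∀ {x y} → a₂₂ x ≡ a₂₂ y → copy x ≡ copy y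
  a₂₂≡⇒copy≡ {x} {y} = index-cong (a₂₂≢0 x) (a₂₂≢0 y)

  toH-cong : ∀ {x y} → Graph._≈_ G x y → Graph._≈_ H (toH x) (toH y)
  toH-cong {x} {y} x≈y with a₁₁≡ , a₁₂≡ , a₂₂≡ ← ≈⇒entries≡ {x} {y} x≈y =
    cong₂ _,_ (a₁₁≡⇒part≡ {x} {y} a₁₁≡) (a₂₂≡⇒copy≡ {x} {y} a₂₂≡) , cong to a₁₂≡

  toH-injective : ∀ {x y} → Graph._≈_ H (toH x) (toH y) → Graph._≈_ G x y
  toH-injective {x} {y} (parts≡ , to-a₁₂≡) = entries≡⇒≈ {x} {y}
    (part≡⇒a₁₁≡ {x} {y} (cong proj₁ parts≡))
    (Enumerated.to-injective enum to-a₁₂≡)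
    (copy≡⇒a₂₂≡ {x} {y} (cong proj₂ parts≡))

  module Preimage (α β : Fin #F*) (t : Fin size) where
    i : ℕ
    i = toℕ α

    i< : i < #F*
    i< = Finₚ.toℕ<n α

    ωⁱ≢0 : ω ^ i ≢ 0#
    ωⁱ≢0 = ω^i≢0 i<

    z y : F
    z = proj₁ (∃-φ^-quotient j ωⁱ≢0 (from t))
    y = proj₁ (∃-φ^-quotient j ωⁱ≢0 (element β))

    ωⁱφz≡t : ω ^ i * φ z ≡ from t
    ωⁱφz≡t = proj₂ (∃-φ^-quotient j ωⁱ≢0 (from t))

    ωⁱφy≡β : ω ^ i * φ y ≡ element β
    ωⁱφy≡β = proj₂ (∃-φ^-quotient j ωⁱ≢0 (element β))

    ωⁱφy≢0 : ω ^ i * φ y ≢ 0#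
    ωⁱφy≢0 = element≢ β ∘ trans (sym ωⁱφy≡β)

    y≢0 : y ≢ 0#
    y≢0 y≡0 = ωⁱφy≢0 (trans (cong (λ y → ω ^ i * φ y) y≡0) (trans (cong (ω ^ i *_) (φ^-0 j)) (zeroʳ _)))

    g : ΓL
    g = record
      { A    = upper (ω ^ i) (ω ^ i * φ z) (ω ^ i * φ y)
      ; detA = *-nonZero ωⁱ≢0 ωⁱφy≢0 ∘ trans (sym (det-upper _ _ _))
      ; i    = j
      }

    g∈V : InV ω i j g
    g∈V = z , y , y≢0 , λ v _ → begin
      act g v                                    ≡⟨ scale-φ^v-upper j (ω ^ i) z y v ⟨
      scale (ω ^ i) (φ^v j (upper 1# z y · v))   ≡⟨ cong (λ c → scale c (φ^v j (upper 1# z y · v))) (^ᴳ≡^ ω i) ⟨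
      scale (ω ^ᴳ i) (φ^v j (upper 1# z y · v))  ∎

    vertex : Vertex
    vertex = g , i , i< , g∈V

    toH-vertex : Graph._≈_ H (toH vertex) ((α , β) , t)
    toH-vertex =
        cong₂ _,_ (Finₚ.fromℕ<-toℕ α i<)
                  (trans (index-cong ωⁱφy≢0 (element≢ β) ωⁱφy≡β) (index-element β (element≢ β)))
      , trans (cong to ωⁱφz≡t) (strictlyInverseˡ t)

  adjacent⇒ : ∀ {x y} → Graph.Adj G x y → Graph.Adj (Ktilde #F* #F*) (part x , copy x) (part y , copy y)
  adjacent⇒ {x} {y} ¬coincide =
      (λ part≡ → ¬coincide (coincide⇐ {x} {y} (inj₁ (part≡⇒a₁₁≡ {x} {y} part≡))))
    , (λ copy≡ → ¬coincide (coincide⇐ {x} {y} (inj₂ (copy≡⇒a₂₂≡ {x} {y} copy≡))))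

  ⇒adjacent : ∀ {x y} → Graph.Adj (Ktilde #F* #F*) (part x , copy x) (part y , copy y) → Graph.Adj G x y
  ⇒adjacent {x} {y} (part≢ , copy≢) coincide with coincide⇒ {x} {y} coincide
  ... | inj₁ a₁₁≡ = part≢ (a₁₁≡⇒part≡ {x} {y} a₁₁≡)
  ... | inj₂ a₂₂≡ = copy≢ (a₂₂≡⇒copy≡ {x} {y} a₂₂≡)

  G≅H : G ≅ H
  G≅H = record
    { f          = toH
    ; f-cong     = λ {x} {y} → toH-cong {x} {y}
    ; injective  = λ {x} {y} → toH-injective {x} {y}
    ; surjective = λ ((α , β) , t) → Preimage.vertex α β t , Preimage.toH-vertex α β t
    ; adj-pres   = λ {x} {y} → inj₁ ∘ adjacent⇒ {x} {y}
    ; adj-refl   = λ { {x} {y} (inj₁ ktilde-adjacent) → ⇒adjacent {x} {y} ktilde-adjacent ; (inj₂ (_ , ())) }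
    }

corollary3p2 : (𝔽 : FiniteField) (p k : ℕ) → Prime p → FiniteField.size 𝔽 ≡ p ℕ.^ k →
    (ω : FiniteField.F 𝔽) → GammaL.Primitive 𝔽 p ω →
    (j : ℕ) → j < k →
    Induced (GammaL.Derangement 𝔽 p) (GammaL.InUnion 𝔽 p ω j)
      ≅ Lex (Ktilde (FiniteField.size 𝔽 ∸ 1) (FiniteField.size 𝔽 ∸ 1))
            (EdgelessK (FiniteField.size 𝔽))
corollary3p2 𝔽 p k p-prime size≡p^k ω ω-primitive j _ = Subgraph.G≅H 𝔽 p k p-prime size≡p^k ω ω-primitive j
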